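{- For every permutation $w\in S_n$, $\phi(R_{\rm bot}(w))=D(w)$.
   Context: For $w\in S_n$, the code is $(c_1,\ldots,c_{n-1})$ with $c_i=|\{j>i:w_j<w_i\}|$, and $R_{\rm bot}(w):=\{(i,j):1\le j\le c_i\}$. For a set $R$ of pairs, list its elements $(i_1,j_1),(i_2,j_2),\ldots$ by increasing $i$ and, for equal $i$, decreasing $j$, and let ${\rm red}(R)=a_1a_2\ldots$ with $a_k=i_k+j_k-1$ (for $R_{\rm bot}(w)$ this is a reduced word for $w$). On words, $\sigma_a$ acts by: regarding each letter $a+1$ as a left and each $a$ as a right parenthesis, the unmatched subword $a^s(a+1)^t$ is replaced by $a^t(a+1)^s$. The plactification map on reduced words: $\phi(\emptyset)=\emptyset$, $\phi(au)=a\,\sigma_a(\phi(u))$. For such $R$ with $\phi({\rm red}(R))=b_1b_2\ldots$, $\phi(R)$ is the set of cells $\{(i_k,b_k)\}$. The diagram of $w$ is $D(w):=\{(i,w_j): i<j,\ w_i>w_j\}\subseteq[n]\times[n]$. -}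

module Defs where

open import Data.Nat using (ℕ; zero; suc; _+_; _∸_; _<ᵇ_; _≡ᵇ_)
open import Data.Bool using (Bool; true; false; if_then_else_; _∨_; _∧_)
open import Data.List using (List; []; _∷_; map; reverse; length; filter; zip; concatMap; downFrom; allFin; zipWith)
open import Data.Fin using (Fin; toℕ)
open import Data.Fin.Permutation using (Permutation′; _⟨$⟩ʳ_)
open import Data.Product using (_×_; _,_; proj₁; proj₂; ∃-syntax)
open import Relation.Binary.PropositionalEquality using (_≡_)
open import Relation.Nullary.Decidable using (_×-dec_)
import Data.Nat as ℕ
import Data.Fin as F

-- Permutations.  w ∈ S_n is a bijection Fin n ↔ Fin n.  Position i : Fin n
-- stands for i+1 ∈ [n]; the value w_{i+1} is toℕ (w ⟨$⟩ʳ i) + 1.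

pos : ∀ {n} → Fin n → ℕ
pos i = suc (toℕ i)

val : ∀ {n} → Permutation′ n → Fin n → ℕ
val w i = suc (toℕ (w ⟨$⟩ʳ i))

code : ∀ {n} → Permutation′ n → Fin n → ℕ
code {n} w i = length (filter (λ j → (i F.<? j) ×-dec (val w j ℕ.<? val w i)) (allFin n))

Cell : Set
Cell = ℕ × ℕ

-- R_bot(w) = {(i,j) : 1 ≤ j ≤ c_i}, listed by increasing i and, for
-- equal i, decreasing j (the order used to read off red(R)).
Rbot : ∀ {n} → Permutation′ n → List Cell
Rbot {n} w = concatMap (λ i → map (λ j → (pos i , suc j)) (downFrom (code w i))) (allFin n)

red : List Cell → List ℕ
red R = map (λ c → proj₁ c + proj₂ c ∸ 1) R

-- The operator σ_a on words.  Letters a+1 are left parentheses, letters a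
-- right parentheses.

-- Scanning left to right with k = number of currently open (unmatched)
-- openers: marks the closers that are unmatched.
unmatchedClosers : (opener closer : ℕ) → ℕ → List ℕ → List Bool
unmatchedClosers o c k [] = []
unmatchedClosers o c k (x ∷ xs) with x ≡ᵇ o | x ≡ᵇ c
... | true  | _     = false ∷ unmatchedClosers o c (suc k) xs
... | false | false = false ∷ unmatchedClosers o c k xs
... | false | true  with k
...   | zero  = true  ∷ unmatchedClosers o c zero xs
...   | suc k′ = false ∷ unmatchedClosers o c k′ xs

unmatchedA : ℕ → List ℕ → List Bool
unmatchedA a u = unmatchedClosers (suc a) a 0 u

unmatchedA1 : ℕ → List ℕ → List Bool
unmatchedA1 a u = reverse (unmatchedClosers a (suc a) 0 (reverse u))

count : List Bool → ℕ
count bs = length (filter (λ b → b Data.Bool.≟ true) bs)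

refill : (a t k : ℕ) → List ℕ → List Bool → List ℕ
refill a t k [] _ = []
refill a t k (x ∷ xs) [] = x ∷ xs
refill a t k (x ∷ xs) (false ∷ bs) = x ∷ refill a t k xs bs
refill a t k (x ∷ xs) (true ∷ bs) =
  (if k <ᵇ t then a else suc a) ∷ refill a t (suc k) xs bs

-- σ_a: the unmatched subword a^s (a+1)^t is replaced by a^t (a+1)^s
σ : ℕ → List ℕ → List ℕ
σ a u = refill a t 0 u (zipWith _∨_ (unmatchedA a u) (unmatchedA1 a u))
  where t = count (unmatchedA1 a u)

φ : List ℕ → List ℕ
φ [] = []
φ (a ∷ u) = a ∷ σ a (φ u)

φR : List Cell → List Cell
φR R = zip (map proj₁ R) (φ (red R))

InD : ∀ {n} → Permutation′ n → Cell → Set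
InD {n} w c = ∃[ i ] ∃[ j ] (i F.< j × val w j ℕ.< val w i × c ≡ (pos i , val w j))

{-# OPTIONS --safe #-}
-- Replace w by any injective sequence g and let the rows of R_bot start at an arbitrary row i,
-- so that dropping the first position gives an instance of the same kind.  Row i of R_bot reads
-- as the decreasing word (i+c-1) … (i+1) i, where c is the first code entry, and all letters of
-- φ of the later rows exceed i.  As the row letters a = i, i+1, … are prepended one at a time,
-- the word σ_a acts on never contains a, so σ_a merely turns each a+1 into a; hence φ(row · rest)
-- is the row followed by φ(rest) with its letters in (i, i+c] lowered by one.  Unwinding this
-- recursion, φ(R_bot) consists of the cells (i + p, i + #{k : g_k < g_q}) with p < q and
-- g_q < g_p; the row-i cells are matched with the pairs (0, q) by an intermediate value argument
-- for y ↦ #{k : g_k < y}.  For a permutation #{k : w_k < w_q} = w_q - 1, which yields D(w).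
module Submission where

open import Defs
open import Data.Nat using (ℕ)
open import Data.Fin.Permutation using (Permutation′)
open import Data.List.Membership.Propositional using (_∈_)
open import Function.Bundles using (_⇔_)

open import Data.Bool using (true; false; if_then_else_; _∨_)
open import Data.Bool.Properties using (T-≡)
open import Data.Nat using (zero; suc; pred; _+_; _≤_; _<_; z≤n; s≤s; _≡ᵇ_; _<ᵇ_)
open import Data.Nat.Properties
open import Data.Fin as Fin using (Fin; toℕ)
import Data.Fin.Properties as Fin
open import Data.Fin.Permutation using (_⟨$⟩ʳ_; _⟨$⟩ˡ_; inverseˡ; inverseʳ)
open import Data.List using (List; []; _∷_; _++_; map; reverse; zipWith; zip; length; filter; downFrom; tabulate; allFin; concat; concatMap)
import Data.List.Properties as List
open import Data.List.Membership.Propositional using (_∉_)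
open import Data.List.Membership.Propositional.Properties
  using (∈-map⁺; ∈-map⁻; ∈-++⁺ˡ; ∈-++⁺ʳ; ∈-++⁻; ∈-downFrom⁺; ∈-downFrom⁻; ∈-tabulate⁺; ∈-tabulate⁻)
open import Data.List.Relation.Unary.All as All using (All)
import Data.List.Relation.Unary.All.Properties as All
open import Data.List.Relation.Unary.Any using (here; there)
open import Data.List.Relation.Unary.Any.Properties using (reverse⁻)
open import Data.List.Relation.Unary.AllPairs using (_∷_)
open import Data.List.Relation.Unary.Unique.Propositional using (Unique)
import Data.List.Relation.Unary.Unique.Propositional.Properties as Unique
open import Data.List.Membership.DecPropositional _≟_ using (_∈?_)
open import Data.List.Relation.Binary.Sublist.Propositional using (⊆-refl)
open import Data.List.Relation.Binary.Sublist.Propositional.Properties using (filter⁺; length-mono-≤)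
open import Data.Product using (_,_; _×_; proj₁; proj₂; map₂; ∃-syntax)
open import Data.Sum using (inj₁; inj₂)
open import Function using (id; _∘_; Equivalence; mk⇔)
open import Function.Definitions using (Injective)
open import Relation.Nullary using (¬_; yes; no; contradiction)
open import Relation.Nullary.Decidable using (_×-dec_)
open import Relation.Unary using (Pred; Decidable)
open import Level using (0ℓ)
open import Relation.Binary.PropositionalEquality
open import Relation.Binary.Definitions using (tri<; tri≈; tri>)

length-filter-tabulate : ∀ {A B : Set} {P : Pred A 0ℓ} {Q : Pred B 0ℓ} (P? : Decidable P) (Q? : Decidable Q) {n}
                         (f : Fin n → A) (h : Fin n → B) →
                         (∀ k → P (f k) → Q (h k)) → (∀ k → Q (h k) → P (f k)) →
                         length (filter P? (tabulate f)) ≡ length (filter Q? (tabulate h))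
length-filter-tabulate P? Q? {zero}  f h P⇒Q Q⇒P = refl
length-filter-tabulate P? Q? {suc n} f h P⇒Q Q⇒P with P? (f Fin.zero) | Q? (h Fin.zero)
... | yes _  | yes _  = cong suc (length-filter-tabulate P? Q? (f ∘ Fin.suc) (h ∘ Fin.suc) (P⇒Q ∘ Fin.suc) (Q⇒P ∘ Fin.suc))
... | no  _  | no  _  = length-filter-tabulate P? Q? (f ∘ Fin.suc) (h ∘ Fin.suc) (P⇒Q ∘ Fin.suc) (Q⇒P ∘ Fin.suc)
... | yes p  | no ¬q = contradiction (P⇒Q Fin.zero p) ¬q
... | no ¬p  | yes q = contradiction (Q⇒P Fin.zero q) ¬p

zip-map₂ : ∀ {A B C : Set} (f : B → C) (xs : List A) ys → zip xs (map f ys) ≡ map (map₂ f) (zip xs ys)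
zip-map₂ f xs ys = trans (cong (λ l → zip l (map f ys)) (sym (List.map-id xs))) (List.zip-map id f xs ys)

countBelow : ℕ → List ℕ → ℕ
countBelow y xs = length (filter (_<? y) xs)

countBelow-accept : ∀ {x y} xs → x < y → countBelow y (x ∷ xs) ≡ suc (countBelow y xs)
countBelow-accept {x} {y} xs x<y = cong length (List.filter-accept (_<? y) {x} {xs} x<y)

countBelow-reject : ∀ {x y} xs → ¬ x < y → countBelow y (x ∷ xs) ≡ countBelow y xs
countBelow-reject {x} {y} xs x≮y = cong length (List.filter-reject (_<? y) {x} {xs} x≮y)

countBelow-zero : ∀ xs → countBelow 0 xs ≡ 0
countBelow-zero xs = cong length (List.filter-none (_<? 0) {xs} (All.tabulate (λ _ → n≮0)))

countBelow-mono : ∀ {y z} xs → y ≤ z → countBelow y xs ≤ countBelow z xs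
countBelow-mono {y} {z} xs y≤z = length-mono-≤ (filter⁺ (_<? y) (_<? z) (λ { refl x<y → <-≤-trans x<y y≤z }) (⊆-refl {x = xs}))

countBelow-suc-∉ : ∀ {t} xs → t ∉ xs → countBelow (suc t) xs ≡ countBelow t xs
countBelow-suc-∉ []       t∉ = refl
countBelow-suc-∉ {t} (x ∷ xs) t∉ with <-cmp x t
... | tri< x<t _ _ = trans (countBelow-accept xs (m<n⇒m<1+n x<t))
                    (trans (cong suc (countBelow-suc-∉ xs (t∉ ∘ there))) (sym (countBelow-accept xs x<t)))
... | tri≈ _ x≡t _ = contradiction (here (sym x≡t)) t∉
... | tri> x≮t _ t<x = trans (countBelow-reject xs (<⇒≱ t<x ∘ ≤-pred))
                    (trans (countBelow-suc-∉ xs (t∉ ∘ there)) (sym (countBelow-reject xs x≮t)))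

countBelow-suc-∈ : ∀ {t xs} → Unique xs → t ∈ xs → countBelow (suc t) xs ≡ suc (countBelow t xs)
countBelow-suc-∈ {t} {t ∷ xs} (t∉ ∷ _) (here refl) = trans (countBelow-accept xs (n<1+n t))
  (cong suc (trans (countBelow-suc-∉ xs (All.All¬⇒¬Any t∉)) (sym (countBelow-reject xs (<-irrefl refl)))))
countBelow-suc-∈ {t} {x ∷ xs} (x∉ ∷ u) (there t∈) with <-cmp x t
... | tri< x<t _ _ = trans (countBelow-accept xs (m<n⇒m<1+n x<t))
                    (trans (cong suc (countBelow-suc-∈ u t∈)) (cong suc (sym (countBelow-accept xs x<t))))
... | tri≈ _ x≡t _ = contradiction x≡t (All.lookup x∉ t∈)
... | tri> x≮t _ t<x = trans (countBelow-reject xs (<⇒≱ t<x ∘ ≤-pred))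
                    (trans (countBelow-suc-∈ u t∈) (cong suc (sym (countBelow-reject xs x≮t))))

countBelow-strict : ∀ {y z xs} → Unique xs → y ∈ xs → y < z → countBelow y xs < countBelow z xs
countBelow-strict {xs = xs} u y∈ y<z = ≤-trans (≤-reflexive (sym (countBelow-suc-∈ u y∈))) (countBelow-mono xs y<z)

countBelow-surjective : ∀ {xs} → Unique xs → ∀ X {m} → m < countBelow X xs →
                        ∃[ y ] (y ∈ xs × y < X × countBelow y xs ≡ m)
countBelow-surjective {xs} u zero m<0 = contradiction (subst (_ <_) (countBelow-zero xs) m<0) n≮0
countBelow-surjective {xs} u (suc t) {m} m<count with t ∈? xs
... | no t∉ with y , y∈ , y<t , eq ← countBelow-surjective u t (subst (m <_) (countBelow-suc-∉ xs t∉) m<count) =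
  y , y∈ , m<n⇒m<1+n y<t , eq
... | yes t∈ with m<1+n⇒m<n∨m≡n (subst (m <_) (countBelow-suc-∈ u t∈) m<count)
...   | inj₂ m≡ = t , t∈ , n<1+n t , sym m≡
...   | inj₁ m< with y , y∈ , y<t , eq ← countBelow-surjective u t m< = y , y∈ , m<n⇒m<1+n y<t , eq

lower : ℕ → ℕ → ℕ
lower a x = if x ≡ᵇ suc a then a else x

lower-hit : ∀ a → lower a (suc a) ≡ a
lower-hit a with suc a ≡ᵇ suc a | ≡⇒≡ᵇ (suc a) (suc a) refl
... | true | _ = refl

lower-miss : ∀ {a x} → x ≢ suc a → lower a x ≡ x
lower-miss {a} {x} x≢ with x ≡ᵇ suc a in eq
... | false = refl
... | true  = contradiction (≡ᵇ⇒≡ x (suc a) (Equivalence.from T-≡ eq)) x≢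

unmatchedClosers-no-closer : ∀ o c k v → c ∉ v → unmatchedClosers o c k v ≡ map (λ _ → false) v
unmatchedClosers-no-closer o c k []      c∉ = refl
unmatchedClosers-no-closer o c k (x ∷ v) c∉ with x ≡ᵇ o | x ≡ᵇ c in eq
... | true  | _     = cong (false ∷_) (unmatchedClosers-no-closer o c (suc k) v (c∉ ∘ there))
... | false | false = cong (false ∷_) (unmatchedClosers-no-closer o c k v (c∉ ∘ there))
... | false | true  = contradiction (here (sym (≡ᵇ⇒≡ x c (Equivalence.from T-≡ eq)))) c∉

unmatchedClosers-no-opener : ∀ o c v → o ∉ v → unmatchedClosers o c 0 v ≡ map (_≡ᵇ c) v
unmatchedClosers-no-opener o c []      o∉ = refl
unmatchedClosers-no-opener o c (x ∷ v) o∉ with x ≡ᵇ o in eq | x ≡ᵇ c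
... | true  | _     = contradiction (here (sym (≡ᵇ⇒≡ x o (Equivalence.from T-≡ eq)))) o∉
... | false | false = cong (false ∷_) (unmatchedClosers-no-opener o c v (o∉ ∘ there))
... | false | true  = cong (true ∷_) (unmatchedClosers-no-opener o c v (o∉ ∘ there))

unmatchedA1-no-a : ∀ a u → a ∉ u → unmatchedA1 a u ≡ map (_≡ᵇ suc a) u
unmatchedA1-no-a a u a∉ = begin
  reverse (unmatchedClosers a (suc a) 0 (reverse u)) ≡⟨ cong reverse (unmatchedClosers-no-opener a (suc a) (reverse u) (a∉ ∘ reverse⁻)) ⟩
  reverse (map (_≡ᵇ suc a) (reverse u))              ≡⟨ cong reverse (List.reverse-map (_≡ᵇ suc a) u) ⟩
  reverse (reverse (map (_≡ᵇ suc a) u))              ≡⟨ List.reverse-involutive _ ⟩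
  map (_≡ᵇ suc a) u                                  ∎
  where open ≡-Reasoning

refill-lowers : ∀ a t k u → k + count (map (_≡ᵇ suc a) u) ≤ t →
                refill a t k u (map (_≡ᵇ suc a) u) ≡ map (lower a) u
refill-lowers a t k []      _ = refl
refill-lowers a t k (x ∷ u) bound with x ≡ᵇ suc a
... | false = cong (x ∷_) (refill-lowers a t k u bound)
... | true  = cong₂ _∷_ refill-head (refill-lowers a t (suc k) u bound′)
  where
  bound′ : suc k + count (map (_≡ᵇ suc a) u) ≤ t
  bound′ = subst (_≤ t) (+-suc k _) bound
  refill-head : (if k <ᵇ t then a else suc a) ≡ a
  refill-head with k <ᵇ t | <⇒<ᵇ (≤-trans (m≤m+n (suc k) _) bound′)
  ... | true | _ = refl

-- Without letters a nothing is matched: every a+1 is unmatched and the unmatched subword (a+1)^t becomes a^t.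
σ-∉ : ∀ a u → a ∉ u → σ a u ≡ map (lower a) u
σ-∉ a u a∉ = begin
  refill a (count (unmatchedA1 a u)) 0 u (zipWith _∨_ (unmatchedA a u) (unmatchedA1 a u))
    ≡⟨ cong₂ (λ a1-marks a-marks → refill a (count a1-marks) 0 u (zipWith _∨_ a-marks a1-marks))
             (unmatchedA1-no-a a u a∉) (unmatchedClosers-no-closer (suc a) a 0 u a∉) ⟩
  refill a (count marks) 0 u (zipWith _∨_ (map (λ _ → false) u) marks)
    ≡⟨ cong (refill a (count marks) 0 u) (no-a-marks u) ⟩
  refill a (count marks) 0 u marks
    ≡⟨ refill-lowers a _ 0 u ≤-refl ⟩
  map (lower a) u ∎
  where
  open ≡-Reasoning
  marks = map (_≡ᵇ suc a) u
  no-a-marks : ∀ v → zipWith _∨_ (map (λ _ → false) v) (map (_≡ᵇ suc a) v) ≡ map (_≡ᵇ suc a) v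
  no-a-marks []      = refl
  no-a-marks (x ∷ v) = cong (_ ∷_) (no-a-marks v)

predUpTo : ℕ → ℕ → ℕ
predUpTo m v with v ≤? m
... | yes _ = pred v
... | no  _ = v

predUpTo-≤ : ∀ {m v} → v ≤ m → predUpTo m v ≡ pred v
predUpTo-≤ {m} {v} v≤m with v ≤? m
... | yes _   = refl
... | no  v≰m = contradiction v≤m v≰m

predUpTo-> : ∀ {m v} → m < v → predUpTo m v ≡ v
predUpTo-> {m} {v} m<v with v ≤? m
... | yes v≤m = contradiction v≤m (<⇒≱ m<v)
... | no  _   = refl

predUpTo-≥ : ∀ {i m v} → suc i ≤ v → i ≤ predUpTo m v
predUpTo-≥ {i} {m} {suc v} (s≤s i≤v) with suc v ≤? m
... | yes _ = i≤v
... | no  _ = m≤n⇒m≤1+n i≤v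

predUpTo-≢ : ∀ {m v} → 0 < v → predUpTo m v ≢ m
predUpTo-≢ {m} {suc v} _ with suc v ≤? m
... | yes v<m = λ v≡m → <⇒≢ v<m v≡m
... | no  v≰m = λ v≡m → v≰m (≤-reflexive v≡m)

lower-predUpTo : ∀ m v → lower m (predUpTo m v) ≡ predUpTo (suc m) v
lower-predUpTo m v with v ≤? m | v ≤? suc m
... | yes v≤m | yes _     = lower-miss (λ eq → <-irrefl eq (s≤s (≤-trans pred[n]≤n v≤m)))
... | yes v≤m | no  v≰1+m = contradiction (m≤n⇒m≤1+n v≤m) v≰1+m
... | no  v≰m | yes v≤1+m rewrite ≤-antisym v≤1+m (≰⇒> v≰m) = lower-hit m
... | no  _   | no  v≰1+m = lower-miss (λ eq → v≰1+m (≤-reflexive eq))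

rowCells : ℕ → ℕ → List Cell
rowCells i c = map (λ j → (i , suc j)) (downFrom c)

rowWord : ℕ → ℕ → List ℕ
rowWord i c = map (i +_) (downFrom c)

red-rowCells : ∀ i c → red (rowCells i c) ≡ rowWord i c
red-rowCells i zero    = refl
red-rowCells i (suc c) = cong₂ _∷_ (cong pred (+-suc i c)) (red-rowCells i c)

rowWord-bounds : ∀ i c → All (λ x → i ≤ x × x < i + c) (rowWord i c)
rowWord-bounds i c = All.map⁺ (All.tabulate (λ j∈ → m≤m+n i _ , +-monoʳ-< i (∈-downFrom⁻ j∈)))

φ-rowWord-++ : ∀ i c rest → All (suc i ≤_) (φ rest) →
               φ (rowWord i c ++ rest) ≡ rowWord i c ++ map (predUpTo (i + c)) (φ rest)
φ-rowWord-++ i zero rest rest≥ =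
  sym (List.map-id-local (All.map (λ i<v → predUpTo-> (≤-trans (s≤s (≤-reflexive (+-identityʳ i))) i<v)) rest≥))
φ-rowWord-++ i (suc c) rest rest≥ = cong (i + c ∷_) (begin
  σ (i + c) (φ (rowWord i c ++ rest))
    ≡⟨ cong (σ (i + c)) (φ-rowWord-++ i c rest rest≥) ⟩
  σ (i + c) (rowWord i c ++ map (predUpTo (i + c)) (φ rest))
    ≡⟨ σ-∉ (i + c) _ i+c∉ ⟩
  map (lower (i + c)) (rowWord i c ++ map (predUpTo (i + c)) (φ rest))
    ≡⟨ List.map-++ (lower (i + c)) (rowWord i c) _ ⟩
  map (lower (i + c)) (rowWord i c) ++ map (lower (i + c)) (map (predUpTo (i + c)) (φ rest))
    ≡⟨ cong₂ _++_ row-fixed (sym (List.map-∘ (φ rest))) ⟩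
  rowWord i c ++ map (lower (i + c) ∘ predUpTo (i + c)) (φ rest)
    ≡⟨ cong (rowWord i c ++_) (List.map-cong lower-shift (φ rest)) ⟩
  rowWord i c ++ map (predUpTo (i + suc c)) (φ rest) ∎)
  where
  open ≡-Reasoning
  lower-shift : ∀ v → lower (i + c) (predUpTo (i + c) v) ≡ predUpTo (i + suc c) v
  lower-shift v = trans (lower-predUpTo (i + c) v) (cong (λ m → predUpTo m v) (sym (+-suc i c)))
  row-fixed : map (lower (i + c)) (rowWord i c) ≡ rowWord i c
  row-fixed = List.map-id-local (All.map (λ (_ , x<) → lower-miss (λ eq → <-asym x< (≤-reflexive (sym eq)))) (rowWord-bounds i c))
  i+c∉ : i + c ∉ rowWord i c ++ map (predUpTo (i + c)) (φ rest)
  i+c∉ i+c∈ with ∈-++⁻ (rowWord i c) i+c∈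
  ... | inj₁ ∈row  = <-irrefl refl (proj₂ (All.lookup (rowWord-bounds i c) ∈row))
  ... | inj₂ ∈rest with v , v∈ , eq ← ∈-map⁻ (predUpTo (i + c)) ∈rest =
    predUpTo-≢ (≤-trans (s≤s z≤n) (All.lookup rest≥ v∈)) (sym eq)

codeOf : ∀ {n} → (Fin n → ℕ) → Fin n → ℕ
codeOf {n} g k = length (filter (λ j → (k Fin.<? j) ×-dec (g j <? g k)) (allFin n))

codeOf-zero : ∀ {n} (g : Fin (suc n) → ℕ) → codeOf g Fin.zero ≡ countBelow (g Fin.zero) (tabulate g)
codeOf-zero {n} g =
  length-filter-tabulate (λ j → (Fin.zero {n} Fin.<? j) ×-dec (g j <? g Fin.zero)) (_<? g Fin.zero) id g (λ _ → proj₂) after-zero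
  where
  after-zero : ∀ j → g j < g Fin.zero → Fin.zero {n} Fin.< j × g j < g Fin.zero
  after-zero Fin.zero    gj<g₀ = contradiction gj<g₀ (<-irrefl refl)
  after-zero (Fin.suc j) gj<g₀ = s≤s z≤n , gj<g₀

codeOf-suc : ∀ {n} (g : Fin (suc n) → ℕ) k → codeOf g (Fin.suc k) ≡ codeOf (g ∘ Fin.suc) k
codeOf-suc g k = trans (cong length (List.filter-reject P? {Fin.zero} {tabulate Fin.suc} (λ ())))
  (length-filter-tabulate P? Q? Fin.suc id (λ _ (k<j , lt) → ≤-pred k<j , lt) (λ _ (k<j , lt) → s≤s k<j , lt))
  where
  P? = λ j → (Fin.suc k Fin.<? j) ×-dec (g j <? g (Fin.suc k))
  Q? = λ j → (k Fin.<? j) ×-dec (g (Fin.suc j) <? g (Fin.suc k))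

RbotOf : ∀ {n} → ℕ → (Fin n → ℕ) → List Cell
RbotOf {n} i g = concatMap (λ k → rowCells (i + toℕ k) (codeOf g k)) (allFin n)

RbotOf-suc : ∀ {n} i (g : Fin (suc n) → ℕ) →
             RbotOf i g ≡ rowCells i (codeOf g Fin.zero) ++ RbotOf (suc i) (g ∘ Fin.suc)
RbotOf-suc i g = cong₂ _++_ (cong (λ r → rowCells r (codeOf g Fin.zero)) (+-identityʳ i)) (cong concat (begin
  map row (tabulate Fin.suc)  ≡⟨ List.map-tabulate Fin.suc row ⟩
  tabulate (row ∘ Fin.suc)    ≡⟨ List.tabulate-cong (λ k → cong₂ rowCells (+-suc i (toℕ k)) (codeOf-suc g k)) ⟩
  tabulate row′               ≡⟨ List.map-tabulate id row′ ⟨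
  map row′ (allFin _)         ∎))
  where
  open ≡-Reasoning
  row  = λ k → rowCells (i + toℕ k) (codeOf g k)
  row′ = λ k → rowCells (suc i + toℕ k) (codeOf (g ∘ Fin.suc) k)

φ-red-RbotOf-≥ : ∀ {n} i (g : Fin n → ℕ) → All (i ≤_) (φ (red (RbotOf i g)))

φ-red-RbotOf-suc : ∀ {n} i (g : Fin (suc n) → ℕ) → let c = codeOf g Fin.zero in
                   φ (red (RbotOf i g)) ≡
                   rowWord i c ++ map (predUpTo (i + c)) (φ (red (RbotOf (suc i) (g ∘ Fin.suc))))
φ-red-RbotOf-suc i g = begin
  φ (red (RbotOf i g))                       ≡⟨ cong (φ ∘ red) (RbotOf-suc i g) ⟩
  φ (red (rowCells i c ++ rest))             ≡⟨ cong φ (List.map-++ _ (rowCells i c) rest) ⟩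
  φ (red (rowCells i c) ++ red rest)         ≡⟨ cong (λ row → φ (row ++ red rest)) (red-rowCells i c) ⟩
  φ (rowWord i c ++ red rest)                ≡⟨ φ-rowWord-++ i c (red rest) (φ-red-RbotOf-≥ (suc i) (g ∘ Fin.suc)) ⟩
  rowWord i c ++ map (predUpTo (i + c)) (φ (red rest)) ∎
  where
  open ≡-Reasoning
  c    = codeOf g Fin.zero
  rest = RbotOf (suc i) (g ∘ Fin.suc)

φ-red-RbotOf-≥ {zero}  i g = All.[]
φ-red-RbotOf-≥ {suc n} i g = subst (All (i ≤_)) (sym (φ-red-RbotOf-suc i g))
  (All.++⁺ (All.map proj₁ (rowWord-bounds i _)) (All.map⁺ (All.map predUpTo-≥ (φ-red-RbotOf-≥ (suc i) (g ∘ Fin.suc)))))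

φRowCells : ℕ → ℕ → List Cell
φRowCells i c = map (λ j → (i , i + j)) (downFrom c)

zip-row-++ : ∀ i c (xs : List ℕ) ys →
             zip (map proj₁ (rowCells i c) ++ xs) (rowWord i c ++ ys) ≡ φRowCells i c ++ zip xs ys
zip-row-++ i zero    xs ys = refl
zip-row-++ i (suc c) xs ys = cong ((i , i + c) ∷_) (zip-row-++ i c xs ys)

φR-RbotOf-suc : ∀ {n} i (g : Fin (suc n) → ℕ) → let c = codeOf g Fin.zero in
                φR (RbotOf i g) ≡ φRowCells i c ++ map (map₂ (predUpTo (i + c))) (φR (RbotOf (suc i) (g ∘ Fin.suc)))
φR-RbotOf-suc i g = begin
  zip (map proj₁ (RbotOf i g)) (φ (red (RbotOf i g)))
    ≡⟨ cong₂ zip (cong (map proj₁) (RbotOf-suc i g)) (φ-red-RbotOf-suc i g) ⟩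
  zip (map proj₁ (rowCells i c ++ rest)) (rowWord i c ++ map shift (φ (red rest)))
    ≡⟨ cong (λ rows → zip rows (rowWord i c ++ map shift (φ (red rest)))) (List.map-++ proj₁ (rowCells i c) rest) ⟩
  zip (map proj₁ (rowCells i c) ++ map proj₁ rest) (rowWord i c ++ map shift (φ (red rest)))
    ≡⟨ zip-row-++ i c _ _ ⟩
  φRowCells i c ++ zip (map proj₁ rest) (map shift (φ (red rest)))
    ≡⟨ cong (φRowCells i c ++_) (zip-map₂ shift _ _) ⟩
  φRowCells i c ++ map (map₂ shift) (φR rest) ∎
  where
  open ≡-Reasoning
  c     = codeOf g Fin.zero
  rest  = RbotOf (suc i) (g ∘ Fin.suc)
  shift = predUpTo (i + c)

InDOf : ∀ {n} → ℕ → (Fin n → ℕ) → Cell → Set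
InDOf i g c = ∃[ a ] ∃[ b ] (a Fin.< b × g b < g a × c ≡ (i + toℕ a , i + countBelow (g b) (tabulate g)))

predUpTo-countBelow : ∀ i x₀ {y ys} → Unique ys → y ∈ ys → y ≢ x₀ →
                      predUpTo (i + countBelow x₀ (x₀ ∷ ys)) (suc i + countBelow y ys) ≡ i + countBelow y (x₀ ∷ ys)
predUpTo-countBelow i x₀ {y} {ys} u y∈ y≢x₀ with <-cmp y x₀
... | tri< y<x₀ _ _ = trans (predUpTo-≤ (≤-trans (≤-reflexive (sym (+-suc i _))) (+-monoʳ-≤ i y<x₀-rank)))
                            (cong (i +_) (sym (countBelow-reject ys (<-asym y<x₀))))
  where
  y<x₀-rank : countBelow y ys < countBelow x₀ (x₀ ∷ ys)
  y<x₀-rank = subst (_ <_) (sym (countBelow-reject ys (<-irrefl refl))) (countBelow-strict u y∈ y<x₀)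
... | tri≈ _ y≡x₀ _ = contradiction y≡x₀ y≢x₀
... | tri> _ _ x₀<y = trans (predUpTo-> (s≤s (+-monoʳ-≤ i x₀≤y-rank)))
                            (sym (trans (cong (i +_) (countBelow-accept ys x₀<y)) (+-suc i _)))
  where
  x₀≤y-rank : countBelow x₀ (x₀ ∷ ys) ≤ countBelow y ys
  x₀≤y-rank = subst (_≤ _) (sym (countBelow-reject ys (<-irrefl refl))) (countBelow-mono ys (<⇒≤ x₀<y))

shifted-cell : ∀ {n} i (g : Fin (suc n) → ℕ) → Injective _≡_ _≡_ g → ∀ (a b : Fin n) →
               map₂ (predUpTo (i + codeOf g Fin.zero)) (suc i + toℕ a , suc i + countBelow (g (Fin.suc b)) (tabulate (g ∘ Fin.suc)))
               ≡ (i + toℕ (Fin.suc a) , i + countBelow (g (Fin.suc b)) (tabulate g))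
shifted-cell i g inj a b = cong₂ _,_ (sym (+-suc i (toℕ a))) (begin
  predUpTo (i + codeOf g Fin.zero) (suc i + countBelow (g (Fin.suc b)) ys)
    ≡⟨ cong (λ c → predUpTo (i + c) (suc i + countBelow (g (Fin.suc b)) ys)) (codeOf-zero g) ⟩
  predUpTo (i + countBelow (g Fin.zero) (g Fin.zero ∷ ys)) (suc i + countBelow (g (Fin.suc b)) ys)
    ≡⟨ predUpTo-countBelow i (g Fin.zero) (Unique.tabulate⁺ (Fin.suc-injective ∘ inj)) (∈-tabulate⁺ b) (Fin.0≢1+n ∘ sym ∘ inj) ⟩
  i + countBelow (g (Fin.suc b)) (tabulate g) ∎)
  where
  open ≡-Reasoning
  ys = tabulate (g ∘ Fin.suc)

∈φR-RbotOf⇒InDOf : ∀ {n} i (g : Fin n → ℕ) → Injective _≡_ _≡_ g → ∀ {c} → c ∈ φR (RbotOf i g) → InDOf i g c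
∈φR-RbotOf⇒InDOf {zero}  i g inj ()
∈φR-RbotOf⇒InDOf {suc n} i g inj {c} c∈ with ∈-++⁻ (φRowCells i (codeOf g Fin.zero)) (subst (c ∈_) (φR-RbotOf-suc i g) c∈)
... | inj₁ c∈row
  with j , j∈ , refl ← ∈-map⁻ (λ j → (i , i + j)) c∈row
  with y , y∈ , y<g₀ , rank≡j ← countBelow-surjective (Unique.tabulate⁺ inj) (g Fin.zero)
                                  (subst (j <_) (codeOf-zero g) (∈-downFrom⁻ j∈))
  with b , refl ← ∈-tabulate⁻ {f = g} y∈
  = Fin.zero , b , zero<b b y<g₀ , y<g₀ , cong₂ _,_ (sym (+-identityʳ i)) (cong (i +_) (sym rank≡j))
  where
  zero<b : ∀ b → g b < g Fin.zero → Fin.zero {n} Fin.< b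
  zero<b Fin.zero    gb<g₀ = contradiction gb<g₀ (<-irrefl refl)
  zero<b (Fin.suc b) _     = s≤s z≤n
... | inj₂ c∈rest
  with c′ , c′∈ , refl ← ∈-map⁻ (map₂ (predUpTo (i + codeOf g Fin.zero))) c∈rest
  with a , b , a<b , gb<ga , refl ← ∈φR-RbotOf⇒InDOf (suc i) (g ∘ Fin.suc) (Fin.suc-injective ∘ inj) c′∈
  = Fin.suc a , Fin.suc b , s≤s a<b , gb<ga , shifted-cell i g inj a b

InDOf⇒∈φR-RbotOf : ∀ {n} i (g : Fin n → ℕ) → Injective _≡_ _≡_ g → ∀ {c} → InDOf i g c → c ∈ φR (RbotOf i g)
InDOf⇒∈φR-RbotOf {suc n} i g inj {c} (Fin.zero , b , _ , gb<g₀ , refl) =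
  subst (c ∈_) (sym (φR-RbotOf-suc i g)) (∈-++⁺ˡ c∈row)
  where
  rank = countBelow (g b) (tabulate g)
  rank<code : rank < codeOf g Fin.zero
  rank<code = subst (rank <_) (sym (codeOf-zero g)) (countBelow-strict (Unique.tabulate⁺ inj) (∈-tabulate⁺ {f = g} b) gb<g₀)
  c∈row : c ∈ φRowCells i (codeOf g Fin.zero)
  c∈row = subst (λ r → (r , i + rank) ∈ φRowCells i (codeOf g Fin.zero)) (sym (+-identityʳ i))
                (∈-map⁺ (λ j → (i , i + j)) (∈-downFrom⁺ rank<code))
InDOf⇒∈φR-RbotOf {suc n} i g inj {c} (Fin.suc a , Fin.suc b , s≤s a<b , gb<ga , refl) =
  subst (c ∈_) (sym (φR-RbotOf-suc i g)) (∈-++⁺ʳ (φRowCells i (codeOf g Fin.zero)) c∈rest)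
  where
  shift = map₂ (predUpTo (i + codeOf g Fin.zero))
  rest  = φR (RbotOf (suc i) (g ∘ Fin.suc))
  c∈rest : c ∈ map shift rest
  c∈rest = subst (_∈ map shift rest) (shifted-cell i g inj a b)
                 (∈-map⁺ shift (InDOf⇒∈φR-RbotOf (suc i) (g ∘ Fin.suc) (Fin.suc-injective ∘ inj) (a , b , a<b , gb<ga , refl)))

val-injective : ∀ {n} (w : Permutation′ n) → Injective _≡_ _≡_ (val w)
val-injective w {a} {b} eq = begin
  a                            ≡⟨ inverseˡ w ⟨
  w ⟨$⟩ˡ (w ⟨$⟩ʳ a)            ≡⟨ cong (w ⟨$⟩ˡ_) (Fin.toℕ-injective (suc-injective eq)) ⟩
  w ⟨$⟩ˡ (w ⟨$⟩ʳ b)            ≡⟨ inverseˡ w ⟩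
  b                            ∎
  where open ≡-Reasoning

countBelow-val : ∀ {n} (w : Permutation′ n) m → m ≤ n → countBelow (suc m) (tabulate (val w)) ≡ m
countBelow-val w zero    _   = trans (countBelow-suc-∉ (tabulate (val w)) 0∉) (countBelow-zero (tabulate (val w)))
  where
  0∉ : 0 ∉ tabulate (val w)
  0∉ 0∈ = 0≢1+n (proj₂ (∈-tabulate⁻ {f = val w} 0∈))
countBelow-val w (suc m) m<n =
  trans (countBelow-suc-∈ (Unique.tabulate⁺ (val-injective w)) 1+m∈) (cong suc (countBelow-val w m (<⇒≤ m<n)))
  where
  1+m∈ : suc m ∈ tabulate (val w)
  1+m∈ = subst (_∈ tabulate (val w)) (cong suc (trans (cong toℕ (inverseʳ w)) (Fin.toℕ-fromℕ< m<n)))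
               (∈-tabulate⁺ (w ⟨$⟩ˡ Fin.fromℕ< m<n))

val-countBelow : ∀ {n} (w : Permutation′ n) b → val w b ≡ suc (countBelow (val w b) (tabulate (val w)))
val-countBelow w b = cong suc (sym (countBelow-val w _ (<⇒≤ (Fin.toℕ<n (w ⟨$⟩ʳ b)))))

InD⇔InDOf : ∀ {n} (w : Permutation′ n) c → InD w c ⇔ InDOf 1 (val w) c
InD⇔InDOf w c = mk⇔
  (λ (a , b , a<b , wb<wa , eq) → a , b , a<b , wb<wa , trans eq (cong (pos a ,_) (val-countBelow w b)))
  (λ (a , b , a<b , wb<wa , eq) → a , b , a<b , wb<wa , trans eq (cong (pos a ,_) (sym (val-countBelow w b))))

proposition6p5 : (n : ℕ) (w : Permutation′ n) (c : Cell) →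
                     (c ∈ φR (Rbot w)) ⇔ InD w c
-- Rbot w is RbotOf 1 (val w) by definition, since pos k = 1 + toℕ k and code w = codeOf (val w).
proposition6p5 n w c = mk⇔
  (Equivalence.from (InD⇔InDOf w c) ∘ ∈φR-RbotOf⇒InDOf 1 (val w) (val-injective w))
  (InDOf⇒∈φR-RbotOf 1 (val w) (val-injective w) ∘ Equivalence.to (InD⇔InDOf w c))
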